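{- Let $T$ be a Cayley tree labelled with $[n]_0$, $n\ge1$. For every non-root vertex $i$, the number of children of $i$ equals the multiplicity of $i$ in the record code $\mathrm{blob}(T)$. The number of children of the root $0$ equals the multiplicity of $0$ in $\mathrm{blob}(T)$ plus one.
   Context: A Cayley tree labelled with $[n]_0=\{0,\dots,n\}$ is a tree on vertex set $[n]_0$ rooted at $0$, with parent map $f_T:[n]\to[n]_0$. A non-root vertex $k$ is a record if $k$ is the largest label on the path from $k$ to the root; let $r_1<r_2<\dots<r_m$ be the records (note $r_m=n$). The record code $\mathrm{blob}(T)$ is the word $x_1x_2\cdots x_{n-1}$ (second row of a two-row array whose first row is $1,\dots,n-1$) where $x_i=f_T(i)$ if $i$ is not a record, and $x_{r_j}=f_T(r_{j+1})$ for $j=1,\dots,m-1$. -}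

module Defs where

open import Data.Nat using (ℕ; zero; suc; _≤_; _<_; _≟_)
open import Data.List using (List; map; upTo; length; filter)
open import Data.Product using (_×_; ∃)
open import Relation.Nullary using (¬_)
open import Relation.Binary.PropositionalEquality using (_≡_)

-- Vertices are natural numbers; the parent map f_T : [n] → [n]_0 is given as
-- a function ℕ → ℕ of which only the values on 1..n matter.

up : (ℕ → ℕ) → ℕ → ℕ
up f zero    = zero
up f (suc m) = f (suc m)

iter : (ℕ → ℕ) → ℕ → ℕ → ℕ
iter g zero    x = x
iter g (suc k) x = g (iter g k x)

IsCayleyTree : ℕ → (ℕ → ℕ) → Set
IsCayleyTree n f =
  (∀ i → 1 ≤ i → i ≤ n → f i ≤ n) ×
  (∀ i → 1 ≤ i → i ≤ n → ∃ λ k → iter (up f) k i ≡ 0)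

IsRecord : ℕ → (ℕ → ℕ) → ℕ → Set
IsRecord n f k = 1 ≤ k × k ≤ n × (∀ j → iter (up f) j k ≤ k)

IsNextRecord : ℕ → (ℕ → ℕ) → ℕ → ℕ → Set
IsNextRecord n f i r =
  IsRecord n f r × i < r × (∀ r′ → IsRecord n f r′ → i < r′ → r ≤ r′)

IsBlob : ℕ → (ℕ → ℕ) → (ℕ → ℕ) → Set
IsBlob n f x =
  ∀ i → 1 ≤ i → suc i ≤ n →
    (¬ IsRecord n f i → x i ≡ f i) ×
    (∀ r → IsRecord n f i → IsNextRecord n f i r → x i ≡ f r)

range1 : ℕ → List ℕ
range1 m = map suc (upTo m)

countIn : ℕ → (ℕ → ℕ) → ℕ → ℕ
countIn m g v = length (filter (λ p → g p ≟ v) (range1 m))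

children : ℕ → (ℕ → ℕ) → ℕ → ℕ
children n f v = countIn n f v

multiplicity : ℕ → (ℕ → ℕ) → ℕ → ℕ
multiplicity n x v = countIn (n Data.Nat.∸ 1) x v

{-# OPTIONS --safe #-}
module Submission where

-- Read the record code from left to right, remembering the next record r after
-- the current position m.  The letters x₁,…,xₘ together with 0 form the same
-- multiset as the parents f(1),…,f(m) together with the pending parent f(r):
-- at a non-record i the letter xᵢ is f(i), and at a record r_j the pending
-- parent f(r_j) is written down while x_{r_j} = f(r_{j+1}) becomes pending.
-- The invariant starts because the first record is a child of the root, and at
-- m = n − 1 the pending record is n itself, so {x₁,…,x_{n−1}, 0} = {f(1),…,f(n)}.

open import Defs
open import Data.Nat using (ℕ; zero; suc; _≤_; _<_; _+_; _*_; _≟_; _≡ᵇ_; z≤n; s≤s)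
open import Data.Nat.Properties
  using (≤-refl; ≤-antisym; ≤-trans; n≤1+n; ≤∧≢⇒<; +-comm; *-suc; +-identityʳ; +-commutativeSemigroup)
open import Algebra.Properties.CommutativeSemigroup +-commutativeSemigroup using (xy∙z≈xz∙y)
open import Data.List using (_∷_; []; _++_; map; upTo; length; filter)
open import Data.List.Properties using (filter-++; length-++; map-++; upTo-∷ʳ)
open import Data.Product using (_×_; _,_; ∃; proj₁; proj₂)
open import Data.Bool using (true; false)
open import Function using (_∘_)
open import Relation.Nullary using (¬_; Dec; yes; no; contradiction)
open import Relation.Nullary.Decidable using (decidable-stable; ¬¬-excluded-middle)
open import Relation.Nullary.Negation using (¬¬-map)
open import Relation.Binary.PropositionalEquality
  using (_≡_; _≢_; refl; sym; trans; cong; cong₂; subst; module ≡-Reasoning)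
open ≡-Reasoning

δ : ℕ → ℕ → ℕ
δ a v = length (filter (_≟ v) (a ∷ []))

length-filter-singleton : ∀ (g : ℕ → ℕ) m v → length (filter (λ p → g p ≟ v) (m ∷ [])) ≡ δ (g m) v
length-filter-singleton g m v with g m ≡ᵇ v
... | true  = refl
... | false = refl

countIn-suc : ∀ m (g : ℕ → ℕ) v → countIn (suc m) g v ≡ countIn m g v + δ (g (suc m)) v
countIn-suc m g v = begin
  length (filter P? (map suc (upTo (suc m))))             ≡⟨ cong (length ∘ filter P? ∘ map suc) (sym (upTo-∷ʳ m)) ⟩
  length (filter P? (map suc (upTo m ++ m ∷ [])))         ≡⟨ cong (length ∘ filter P?) (map-++ suc (upTo m) (m ∷ [])) ⟩
  length (filter P? (range1 m ++ suc m ∷ []))             ≡⟨ cong length (filter-++ P? (range1 m) (suc m ∷ [])) ⟩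
  length (filter P? (range1 m) ++ filter P? (suc m ∷ [])) ≡⟨ length-++ (filter P? (range1 m)) ⟩
  countIn m g v + length (filter P? (suc m ∷ []))         ≡⟨ cong (countIn m g v +_) (length-filter-singleton g (suc m) v) ⟩
  countIn m g v + δ (g (suc m)) v                         ∎
  where
    P? : ∀ p → Dec (g p ≡ v)
    P? p = g p ≟ v

iter-suc′ : ∀ (g : ℕ → ℕ) k x → iter g k (g x) ≡ iter g (suc k) x
iter-suc′ g zero    x = refl
iter-suc′ g (suc k) x = cong g (iter-suc′ g k x)

iter-+ : ∀ (g : ℕ → ℕ) a b x → iter g (a + b) x ≡ iter g a (iter g b x)
iter-+ g zero    b x = refl
iter-+ g (suc a) b x = cong g (iter-+ g a b x)

iter-periodic : ∀ (g : ℕ → ℕ) {p x} → iter g p x ≡ x → ∀ t → iter g (t * p) x ≡ x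
iter-periodic g         e zero    = refl
iter-periodic g {p} {x} e (suc t) = begin
  iter g (p + t * p) x        ≡⟨ iter-+ g p (t * p) x ⟩
  iter g p (iter g (t * p) x) ≡⟨ cong (iter g p) (iter-periodic g e t) ⟩
  iter g p x                  ≡⟨ e ⟩
  x                           ∎

iter-up-root : ∀ f k → iter (up f) k 0 ≡ 0
iter-up-root f zero    = refl
iter-up-root f (suc k) = cong (up f) (iter-up-root f k)

iter-up-stays-root : ∀ f {K x} → iter (up f) K x ≡ 0 → ∀ L → iter (up f) (L + K) x ≡ 0
iter-up-stays-root f {K} {x} e L = begin
  iter (up f) (L + K) x             ≡⟨ iter-+ (up f) L K x ⟩
  iter (up f) L (iter (up f) K x)   ≡⟨ cong (iter (up f) L) e ⟩
  iter (up f) L 0                   ≡⟨ iter-up-root f L ⟩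
  0                                 ∎

iter-up-via-parent : ∀ f {p q} → f (suc p) ≡ q → ∀ j → iter (up f) j q ≡ iter (up f) (suc j) (suc p)
iter-up-via-parent f {p} fp j = trans (cong (iter (up f) j) (sym fp)) (iter-suc′ (up f) j (suc p))

module CayleyTree {n : ℕ} {f : ℕ → ℕ} (tree : IsCayleyTree n f) where

  iter-up-≤ : ∀ k {p} → p ≤ n → iter (up f) k p ≤ n
  iter-up-≤ zero    p≤n = p≤n
  iter-up-≤ (suc k) {p} p≤n with iter (up f) k p | iter-up-≤ k p≤n
  ... | zero  | _ = z≤n
  ... | suc q | q<n = proj₁ tree (suc q) (s≤s z≤n) q<n

  -- The last vertex before the root on a path is a record.
  record-on-path : ∀ d {p} → 1 ≤ p → p ≤ n → iter (up f) d p ≡ 0 →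
                   ∃ λ j → IsRecord n f (iter (up f) j p)
  record-on-path zero (s≤s _) _ ()
  record-on-path (suc d) {suc p} 1≤p p≤n reach with f (suc p) in fp
  ... | zero = 0 , 1≤p , p≤n , below
    where
      below : ∀ j → iter (up f) j (suc p) ≤ suc p
      below zero    = ≤-refl
      below (suc j) = subst (_≤ suc p) (trans (sym (iter-up-root f j)) (iter-up-via-parent f fp j)) z≤n
  ... | suc q with record-on-path d (s≤s z≤n) (subst (_≤ n) fp (proj₁ tree (suc p) 1≤p p≤n))
                                   (trans (iter-up-via-parent f fp d) reach)
  ...   | j , isRecord = suc j , subst (IsRecord n f) (iter-up-via-parent f fp j) isRecord

  record-towards-root : ∀ {p} → 1 ≤ p → p ≤ n → ∃ λ j → IsRecord n f (iter (up f) j p)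
  record-towards-root 1≤p p≤n = let d , reach = proj₂ tree _ 1≤p p≤n in record-on-path d 1≤p p≤n reach

  acyclic : ∀ {p} → 1 ≤ p → p ≤ n → ∀ j → iter (up f) (suc j) p ≢ p
  acyclic {p} 1≤p p≤n j cycle with proj₂ tree p 1≤p p≤n | 1≤p
  ... | K , reach | s≤s _ = contradiction p≡0 λ ()
    where
      p≡0 : p ≡ 0
      p≡0 = begin
        p                         ≡⟨ sym (iter-periodic (up f) cycle K) ⟩
        iter (up f) (K * suc j) p ≡⟨ cong (λ t → iter (up f) t p) (trans (*-suc K j) (+-comm K (K * j))) ⟩
        iter (up f) (K * j + K) p ≡⟨ iter-up-stays-root f reach (K * j) ⟩
        0                         ∎

  -- A record c on the path from the parent of the first record r would satisfy
  -- both c ≤ r (r is a record) and r ≤ c (r is the first one), closing a cycle.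
  first-record-child-of-root : ∀ {r} → IsNextRecord n f 0 r → f r ≡ 0
  first-record-child-of-root {suc r} ((1≤r , r≤n , r-max) , _ , r-first) with f (suc r) in fr
  ... | zero  = refl
  ... | suc q with record-towards-root (s≤s z≤n) (subst (_≤ n) fr (proj₁ tree (suc r) 1≤r r≤n))
  ...   | j , c-record@(1≤c , _ , _) = contradiction cycle (acyclic 1≤r r≤n j)
    where
      cycle : iter (up f) (suc j) (suc r) ≡ suc r
      cycle = ≤-antisym (r-max (suc j)) (subst (suc r ≤_) (iter-up-via-parent f fr j) (r-first _ c-record 1≤c))

  last-record : ∀ {m} → n ≡ suc m → IsNextRecord n f m n
  last-record refl = (s≤s z≤n , ≤-refl , λ j → iter-up-≤ j ≤-refl) , ≤-refl , λ _ _ m<r → m<r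

module RecordCode {n : ℕ} {f x : ℕ → ℕ} (tree : IsCayleyTree n f) (blob : IsBlob n f x) where

  next-record-at-record : ∀ {m} → IsRecord n f (suc m) → IsNextRecord n f m (suc m)
  next-record-at-record isRecord = isRecord , ≤-refl , λ _ _ m<r → m<r

  next-record-past-non-record : ∀ {m r} → ¬ IsRecord n f (suc m) →
                                IsNextRecord n f (suc m) r → IsNextRecord n f m r
  next-record-past-non-record {m} {r} nonRecord (isRecord , sm<r , r-first) =
    isRecord , ≤-trans (n≤1+n (suc m)) sm<r , r-first′
    where
      r-first′ : ∀ r′ → IsRecord n f r′ → m < r′ → r ≤ r′
      r-first′ r′ r′-record m<r′ with suc m ≟ r′
      ... | yes refl = contradiction r′-record nonRecord
      ... | no  sm≢r′ = r-first r′ r′-record (≤∧≢⇒< m<r′ sm≢r′)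

  code-invariant : ∀ v m → m < n → ∀ {r} → IsNextRecord n f m r →
                   countIn m x v + δ 0 v ≡ countIn m f v + δ (f r) v
  code-invariant v zero    _    nr = cong (λ a → δ a v) (sym (CayleyTree.first-record-child-of-root tree nr))
  code-invariant v (suc m) sm<n {r} nr =
    -- Being a record need not be decidable, but the goal is an equation in ℕ,
    -- so a classical case split on it is harmless.
    decidable-stable (_ ≟ _) (¬¬-map by-cases ¬¬-excluded-middle)
    where
      ih : ∀ {r′} → IsNextRecord n f m r′ → countIn m x v + δ 0 v ≡ countIn m f v + δ (f r′) v
      ih = code-invariant v m (≤-trans (n≤1+n (suc m)) sm<n)

      letter-at-record : IsRecord n f (suc m) → x (suc m) ≡ f r
      letter-at-record isRecord = proj₂ (blob (suc m) (s≤s z≤n) sm<n) r isRecord nr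

      letter-at-non-record : ¬ IsRecord n f (suc m) → x (suc m) ≡ f (suc m)
      letter-at-non-record = proj₁ (blob (suc m) (s≤s z≤n) sm<n)

      read-letter : countIn (suc m) x v + δ 0 v ≡ (countIn m x v + δ 0 v) + δ (x (suc m)) v
      read-letter = trans (cong (_+ δ 0 v) (countIn-suc m x v)) (xy∙z≈xz∙y (countIn m x v) _ _)

      by-cases : Dec (IsRecord n f (suc m)) →
                 countIn (suc m) x v + δ 0 v ≡ countIn (suc m) f v + δ (f r) v
      by-cases (yes isRecord) = begin
        countIn (suc m) x v + δ 0 v                         ≡⟨ read-letter ⟩
        (countIn m x v + δ 0 v) + δ (x (suc m)) v           ≡⟨ cong₂ _+_ (ih (next-record-at-record isRecord))
                                                                         (cong (λ a → δ a v) (letter-at-record isRecord)) ⟩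
        (countIn m f v + δ (f (suc m)) v) + δ (f r) v       ≡⟨ cong (_+ δ (f r) v) (countIn-suc m f v) ⟨
        countIn (suc m) f v + δ (f r) v                     ∎
      by-cases (no nonRecord) = begin
        countIn (suc m) x v + δ 0 v                         ≡⟨ read-letter ⟩
        (countIn m x v + δ 0 v) + δ (x (suc m)) v           ≡⟨ cong₂ _+_ (ih (next-record-past-non-record nonRecord nr))
                                                                         (cong (λ a → δ a v) (letter-at-non-record nonRecord)) ⟩
        (countIn m f v + δ (f r) v) + δ (f (suc m)) v       ≡⟨ xy∙z≈xz∙y (countIn m f v) _ _ ⟩
        (countIn m f v + δ (f (suc m)) v) + δ (f r) v       ≡⟨ cong (_+ δ (f r) v) (countIn-suc m f v) ⟨
        countIn (suc m) f v + δ (f r) v                     ∎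

lemma2p2 : (n : ℕ) → 1 ≤ n → (f : ℕ → ℕ) → IsCayleyTree n f →
    (x : ℕ → ℕ) → IsBlob n f x →
    (∀ i → 1 ≤ i → i ≤ n → children n f i ≡ multiplicity n x i) ×
    (children n f 0 ≡ suc (multiplicity n x 0))
lemma2p2 (suc n) _ f tree x blob = non-root , root
  where
    counts : ∀ v → multiplicity (suc n) x v + δ 0 v ≡ children (suc n) f v
    counts v = begin
      countIn n x v + δ 0 v                     ≡⟨ RecordCode.code-invariant tree blob v n ≤-refl (CayleyTree.last-record tree refl) ⟩
      countIn n f v + δ (f (suc n)) v           ≡⟨ countIn-suc n f v ⟨
      countIn (suc n) f v                       ∎

    non-root : ∀ i → 1 ≤ i → i ≤ suc n → children (suc n) f i ≡ multiplicity (suc n) x i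
    non-root (suc i) _ _ = trans (sym (counts (suc i))) (+-identityʳ _)

    root : children (suc n) f 0 ≡ suc (multiplicity (suc n) x 0)
    root = trans (sym (counts 0)) (+-comm _ 1)
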